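{- Let $\mathcal M=(M_n)_{n\ge1}$ be an $\mathrm{Inc}$-invariant chain of monoids $M_n\subseteq\mathbb Z^n_{\ge0}$ with limit $M_\infty=\bigcup_nM_n$. Consider: (a) $\mathcal M$ stabilizes and $M_n$ is a finitely generated monoid for all sufficiently large $n$; (b) $M_\infty$ is $\mathrm{Inc}$-equivariantly finitely generated, i.e. $M_\infty=\mathrm{Mon}(\mathrm{Inc}(G))$ for some finite $G\subseteq M_\infty$. Then (a) implies (b), and if $\mathcal M$ is eventually saturated (i.e. $M_n=M_\infty\cap\mathbb Z^n_{\ge0}$ for all large $n$), then (a) and (b) are equivalent.
   Context: Identify $\mathbb Z^m$ with a subset of $\mathbb Z^n$ ($m\le n$) via $v\mapsto(v,0,\dots,0)$, and let $\mathbb Z^{(\mathbb N)}_{\ge0}=\bigcup_n\mathbb Z^n_{\ge0}$. $\mathrm{Mon}(A)=\{\sum_{i=1}^km_ia_i: k\in\mathbb N, a_i\in A, m_i\in\mathbb Z_{\ge0}\}$; a monoid here is a set $M$ with $\mathrm{Mon}(M)=M$. $\mathrm{Inc}$ is the monoid of strictly increasing maps $\mathbb N\to\mathbb N$ and $\mathrm{Inc}_{m,n}=\{\pi\in\mathrm{Inc}:\pi(m)\le n\}$; $\pi\in\mathrm{Inc}_{m,n}$ acts $\mathbb Z^m\to\mathbb Z^n$ by $\pi(\sum_{k\le m}v_k\epsilon_k)=\sum_kv_k\epsilon_{\pi(k)}$, and $\mathrm{Inc}$ acts on $\mathbb Z^{(\mathbb N)}$ likewise. A chain of monoids has $M_n\subseteq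 M_{n+1}$; it is $\mathrm{Inc}$-invariant if $\mathrm{Mon}(\mathrm{Inc}_{m,n}(M_m))\subseteq M_n$ for all $n\ge m$, and stabilizes if there is $r$ with $\mathrm{Mon}(\mathrm{Inc}_{m,n}(M_m))=M_n$ for all $n\ge m\ge r$. -}

module Defs where

open import Data.Nat using (ℕ; zero; suc; _+_; _*_; _≤_; _<_; _≡ᵇ_)
open import Data.Bool using (if_then_else_)
open import Data.Fin using (Fin; toℕ)
open import Data.Vec using (Vec; []; _∷_; tabulate; replicate; zipWith; map)
open import Data.List using (List; []; _∷_)
open import Data.List.Relation.Unary.All using (All)
open import Data.List.Membership.Propositional using (_∈_)
open import Data.Product using (Σ; ∃; _×_; _,_; proj₁; proj₂)
open import Relation.Binary.PropositionalEquality using (_≡_)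

-- Elements of ℤ^n_{≥0} are vectors  Vec ℕ n  (coordinates indexed 0..n-1).
-- A subset of ℤ^n_{≥0} is a predicate  Vec ℕ n → Set.
Subset : ℕ → Set₁
Subset n = Vec ℕ n → Set

-- i-th coordinate of a vector, 0 outside its length (the identification ℤ^n ⊆ ℤ^N)
coord : ∀ {n} → Vec ℕ n → ℕ → ℕ
coord []       _       = 0
coord (x ∷ xs) zero    = x
coord (x ∷ xs) (suc i) = coord xs i

-- the vector v ∈ ℤ^n viewed in ℤ^N (padding with zeros, N ≥ n in all uses)
padTo : ∀ {n} (N : ℕ) → Vec ℕ n → Vec ℕ N
padTo N v = tabulate (λ j → coord v (toℕ j))

_+ᵥ_ : ∀ {n} → Vec ℕ n → Vec ℕ n → Vec ℕ n
_+ᵥ_ = zipWith _+_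

_⋆_ : ∀ {n} → ℕ → Vec ℕ n → Vec ℕ n
c ⋆ v = map (c *_) v

lincomb : ∀ {n} → List (ℕ × Vec ℕ n) → Vec ℕ n
lincomb []             = replicate _ 0
lincomb ((c , a) ∷ l)  = (c ⋆ a) +ᵥ lincomb l

Mon : ∀ {n} → Subset n → Subset n
Mon {n} A v = Σ (List (ℕ × Vec ℕ n)) λ l → All (λ p → A (proj₂ p)) l × v ≡ lincomb l

StrictInc : (ℕ → ℕ) → Set
StrictInc π = ∀ i j → i < j → π i < π j

-- Inc_{m,n} (0-indexed: π(m) ≤ n in 1-indexed form becomes π k < n for all k < m)
InIncMN : ℕ → ℕ → (ℕ → ℕ) → Set
InIncMN m n π = StrictInc π × (∀ k → k < m → π k < n)

-- j-th coordinate of π(u) = Σ_k u_k ε_{π(k)}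
actCoord : ∀ {m} → (ℕ → ℕ) → Vec ℕ m → ℕ → ℕ
actCoord π []       j = 0
actCoord π (x ∷ xs) j = (if π 0 ≡ᵇ j then x else 0) + actCoord (λ k → π (suc k)) xs j

act : ∀ {m} → (ℕ → ℕ) → Vec ℕ m → (n : ℕ) → Vec ℕ n
act π u n = tabulate (λ j → actCoord π u (toℕ j))

Chain : Set₁
Chain = (n : ℕ) → Subset n

IncImage : Chain → (m n : ℕ) → Subset n
IncImage M m n v = Σ (ℕ → ℕ) λ π → InIncMN m n π × Σ (Vec ℕ m) λ u → M m u × v ≡ act π u n

IsIncInvariantChainOfMonoids : Chain → Set
IsIncInvariantChainOfMonoids M =
  (∀ n v → Mon (M n) v → M n v)
  × (∀ n v → M n v → M (suc n) (padTo (suc n) v))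
  × (∀ m n → m ≤ n → ∀ v → Mon (IncImage M m n) v → M n v)

MInf : Chain → (n : ℕ) → Subset n
MInf M n v = Σ ℕ λ N → n ≤ N × M N (padTo N v)

Stabilizes : Chain → Set
Stabilizes M = Σ ℕ λ r → ∀ m n → r ≤ m → m ≤ n → ∀ v →
  (Mon (IncImage M m n) v → M n v) × (M n v → Mon (IncImage M m n) v)

FinGenMonoid : ∀ {n} → Subset n → Set
FinGenMonoid {n} A = Σ (List (Vec ℕ n)) λ G → ∀ v →
  (A v → Mon (λ w → w ∈ G) v) × (Mon (λ w → w ∈ G) v → A v)

CondA : Chain → Set
CondA M = Stabilizes M × (Σ ℕ λ r → ∀ n → r ≤ n → FinGenMonoid (M n))

-- Inc(G) for finite G ⊆ ℤ^(ℕ) (elements given as (m , g) with g ∈ ℤ^m), intersected with ℤ^N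
IncGImage : List (Σ ℕ (Vec ℕ)) → (N : ℕ) → Subset N
IncGImage G N w = Σ (Σ ℕ (Vec ℕ)) λ p → p ∈ G ×
  Σ (ℕ → ℕ) λ π → InIncMN (proj₁ p) N π × w ≡ act π (proj₂ p) N

-- membership of v ∈ ℤ^n in Mon(Inc(G)) ⊆ ℤ^(ℕ): some N ≥ n with v a combination of
-- elements π(g), g ∈ G, all lying in ℤ^N
MonIncG : List (Σ ℕ (Vec ℕ)) → (n : ℕ) → Subset n
MonIncG G n v = Σ ℕ λ N → n ≤ N × Mon (IncGImage G N) (padTo N v)

CondB : Chain → Set
CondB M = Σ (List (Σ ℕ (Vec ℕ))) λ G →
  All (λ p → MInf M (proj₁ p) (proj₂ p)) G
  × (∀ n v → (MInf M n v → MonIncG G n v) × (MonIncG G n v → MInf M n v))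

EventuallySaturated : Chain → Set
EventuallySaturated M = Σ ℕ λ r → ∀ n → r ≤ n → ∀ v →
  (M n v → MInf M n v) × (MInf M n v → M n v)

-- (a) ⇒ (b): take s beyond both the stabilization index and the finite-generation index;
-- every element of M_∞ lies in some M_N with N ≥ s, hence in Mon(Inc_{s,N}(M_s)), and so
-- the generators of M_s generate M_∞ equivariantly.
-- (b) ⇒ (a): by saturation M_n = M_∞ ∩ ℤ^n, and an element of ℤ^n written through Inc(G)
-- only uses the elements π(g) that themselves lie in ℤ^n. Such a π(g) ∈ ℤ^(n+1) is either g
-- itself (π fixes 0..n) or punchIn a applied to an element of Inc(g) ∩ ℤ^n, where a is a
-- value missed by π. Iterating this shows that Inc(g) ∩ ℤ^n is finite, which gives finite
-- generation, and that for n ≥ m ≥ |g| every π(g) ∈ ℤ^n is τ(w) with τ ∈ Inc_{m,n} and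
-- w ∈ Inc(g) ∩ ℤ^m ⊆ M_m, which gives stabilization.
module Submission where

open import Defs
open import Algebra.Properties.CommutativeSemigroup using (interchange)
open import Data.Bool using (true; false; if_then_else_)
open import Data.Empty using (⊥-elim)
open import Data.Fin using (toℕ)
open import Data.List using (List; []; _∷_; _++_; map; concatMap; upTo; cartesianProductWith)
open import Data.List.Extrema.Nat using (max; ⊥≤max; xs≤max)
open import Data.List.Membership.Propositional using (_∈_)
open import Data.List.Membership.Propositional.Properties
  using (∈-++⁻; ∈-++⁺ˡ; ∈-++⁺ʳ; ∈-upTo⁺; ∈-map⁺; ∈-map⁻; ∈-concat⁺′; ∈-concat⁻′;
         ∈-cartesianProductWith⁺; ∈-cartesianProductWith⁻)
open import Data.List.Relation.Unary.All as All using (All; []; _∷_)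
import Data.List.Relation.Unary.All.Properties as AllP
open import Data.List.Relation.Unary.Any using (here)
open import Data.Nat using (ℕ; zero; suc; pred; _+_; _*_; _≤_; _<_; _≡ᵇ_; z≤n; s≤s)
open import Data.Nat.Properties
open import Data.Product using (Σ; _×_; _,_; proj₁; proj₂)
open import Data.Sum using (_⊎_; inj₁; inj₂; [_,_]′)
open import Data.Vec using (Vec; []; _∷_; tabulate; replicate)
open import Function using (_∘_; id)
open import Relation.Binary.Definitions using (tri<; tri≈; tri>)
open import Relation.Binary.PropositionalEquality
open import Relation.Nullary using (Dec; yes; no)

if-≡ : ∀ {a b} x → a ≡ b → (if a ≡ᵇ b then x else 0) ≡ x
if-≡ {a} {b} x a≡b with a ≡ᵇ b | ≡⇒≡ᵇ a b a≡b
... | true | _ = refl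

if-≢ : ∀ {a b} x → a ≢ b → (if a ≡ᵇ b then x else 0) ≡ 0
if-≢ {a} {b} x a≢b with a ≡ᵇ b | ≡ᵇ⇒≡ a b
... | true  | sound = ⊥-elim (a≢b (sound _))
... | false | _     = refl

if-0 : ∀ t → (if t then 0 else 0) ≡ 0
if-0 true  = refl
if-0 false = refl

if-+ : ∀ t x y → (if t then x + y else 0) ≡ (if t then x else 0) + (if t then y else 0)
if-+ true  x y = refl
if-+ false x y = refl

if-* : ∀ t c x → (if t then c * x else 0) ≡ c * (if t then x else 0)
if-* true  c x = refl
if-* false c x = sym (*-zeroʳ c)

VanishesFrom : ℕ → (ℕ → ℕ) → Set
VanishesFrom n f = ∀ k → n ≤ k → f k ≡ 0

vanishesFrom-mono : ∀ {m n f} → m ≤ n → VanishesFrom m f → VanishesFrom n f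
vanishesFrom-mono m≤n f0 k n≤k = f0 k (≤-trans m≤n n≤k)

coord-vanishes : ∀ {n} (v : Vec ℕ n) → VanishesFrom n (coord v)
coord-vanishes []      k       _         = refl
coord-vanishes (x ∷ v) (suc k) (s≤s n≤k) = coord-vanishes v k n≤k

coord-tabulate-< : ∀ n (h : ℕ → ℕ) {i} → i < n → coord (tabulate {n = n} (h ∘ toℕ)) i ≡ h i
coord-tabulate-< (suc n) h {zero}  _         = refl
coord-tabulate-< (suc n) h {suc i} (s≤s i<n) = coord-tabulate-< n (h ∘ suc) i<n

coord-tabulate : ∀ n {h : ℕ → ℕ} → VanishesFrom n h → coord (tabulate {n = n} (h ∘ toℕ)) ≗ h
coord-tabulate n {h} h0 i with i <? n
... | yes i<n = coord-tabulate-< n h i<n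
... | no  i≮n = trans (coord-vanishes (tabulate {n = n} (h ∘ toℕ)) i (≮⇒≥ i≮n)) (sym (h0 i (≮⇒≥ i≮n)))

coord-ext : ∀ {n} {u v : Vec ℕ n} → (∀ i → i < n → coord u i ≡ coord v i) → u ≡ v
coord-ext {u = []}    {[]}    _   = refl
coord-ext {u = x ∷ u} {y ∷ v} u≈v =
  cong₂ _∷_ (u≈v 0 (s≤s z≤n)) (coord-ext (λ i i<n → u≈v (suc i) (s≤s i<n)))

coord-padTo-< : ∀ {n} N (v : Vec ℕ n) {i} → i < N → coord (padTo N v) i ≡ coord v i
coord-padTo-< N v = coord-tabulate-< N (coord v)

coord-padTo : ∀ {n} N (v : Vec ℕ n) → VanishesFrom N (coord v) → coord (padTo N v) ≗ coord v
coord-padTo N v = coord-tabulate N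

padTo-self : ∀ {n} (v : Vec ℕ n) → padTo n v ≡ v
padTo-self {n} v = coord-ext (λ i → coord-padTo-< n v)

padTo-padTo : ∀ {n} K N (v : Vec ℕ n) → n ≤ N → padTo K (padTo N v) ≡ padTo K v
padTo-padTo K N v n≤N = coord-ext λ i i<K → begin
  coord (padTo K (padTo N v)) i ≡⟨ coord-padTo-< K (padTo N v) i<K ⟩
  coord (padTo N v) i           ≡⟨ coord-padTo N v (vanishesFrom-mono n≤N (coord-vanishes v)) i ⟩
  coord v i                     ≡⟨ coord-padTo-< K v i<K ⟨
  coord (padTo K v) i           ∎
  where open ≡-Reasoning

coord-+ᵥ : ∀ {n} (u v : Vec ℕ n) i → coord (u +ᵥ v) i ≡ coord u i + coord v i
coord-+ᵥ []      []      i       = refl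
coord-+ᵥ (x ∷ u) (y ∷ v) zero    = refl
coord-+ᵥ (x ∷ u) (y ∷ v) (suc i) = coord-+ᵥ u v i

coord-⋆ : ∀ {n} c (v : Vec ℕ n) i → coord (c ⋆ v) i ≡ c * coord v i
coord-⋆ c []      i       = sym (*-zeroʳ c)
coord-⋆ c (x ∷ v) zero    = refl
coord-⋆ c (x ∷ v) (suc i) = coord-⋆ c v i

coord-replicate-0 : ∀ n i → coord (replicate n 0) i ≡ 0
coord-replicate-0 zero    i       = refl
coord-replicate-0 (suc n) zero    = refl
coord-replicate-0 (suc n) (suc i) = coord-replicate-0 n i

coord-lincomb-∷ : ∀ {n} c (a : Vec ℕ n) l i →
  coord (lincomb ((c , a) ∷ l)) i ≡ c * coord a i + coord (lincomb l) i
coord-lincomb-∷ c a l i = trans (coord-+ᵥ (c ⋆ a) (lincomb l) i) (cong (_+ coord (lincomb l) i) (coord-⋆ c a i))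

padTo-lincomb-∷ : ∀ {N} n c (a : Vec ℕ N) l → padTo n (lincomb ((c , a) ∷ l)) ≡ (c ⋆ padTo n a) +ᵥ padTo n (lincomb l)
padTo-lincomb-∷ n c a l = coord-ext λ i i<n → begin
  coord (padTo n (lincomb ((c , a) ∷ l))) i                  ≡⟨ coord-padTo-< n (lincomb ((c , a) ∷ l)) i<n ⟩
  coord (lincomb ((c , a) ∷ l)) i                            ≡⟨ coord-lincomb-∷ c a l i ⟩
  c * coord a i + coord (lincomb l) i                        ≡⟨ cong₂ (λ x y → c * x + y) (coord-padTo-< n a i<n) (coord-padTo-< n (lincomb l) i<n) ⟨
  c * coord (padTo n a) i + coord (padTo n (lincomb l)) i    ≡⟨ cong (_+ _) (coord-⋆ c (padTo n a) i) ⟨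
  coord (c ⋆ padTo n a) i + coord (padTo n (lincomb l)) i    ≡⟨ coord-+ᵥ (c ⋆ padTo n a) (padTo n (lincomb l)) i ⟨
  coord ((c ⋆ padTo n a) +ᵥ padTo n (lincomb l)) i           ∎
  where open ≡-Reasoning

-- push π f L j = Σ_{k < L, π k = j} f k : the coordinates of π applied to a vector with coordinates f below L.
push : (ℕ → ℕ) → (ℕ → ℕ) → ℕ → ℕ → ℕ
push π f zero    j = 0
push π f (suc L) j = (if π 0 ≡ᵇ j then f 0 else 0) + push (π ∘ suc) (f ∘ suc) L j

push-cong : ∀ L π {f h} j → (∀ k → k < L → f k ≡ h k) → push π f L j ≡ push π h L j
push-cong zero    π j f≈h = refl
push-cong (suc L) π j f≈h =
  cong₂ _+_ (cong (if π 0 ≡ᵇ j then_else 0) (f≈h 0 (s≤s z≤n)))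
            (push-cong L (π ∘ suc) j (λ k k<L → f≈h (suc k) (s≤s k<L)))

push-congˡ : ∀ L {π σ} f j → (∀ k → k < L → π k ≡ σ k ⊎ f k ≡ 0) → push π f L j ≡ push σ f L j
push-congˡ zero    f j π≈σ = refl
push-congˡ (suc L) {π} {σ} f j π≈σ =
  cong₂ _+_ head (push-congˡ L (f ∘ suc) j (λ k k<L → π≈σ (suc k) (s≤s k<L)))
  where
  head : (if π 0 ≡ᵇ j then f 0 else 0) ≡ (if σ 0 ≡ᵇ j then f 0 else 0)
  head with π≈σ 0 (s≤s z≤n)
  ... | inj₁ π0≡σ0 = cong (λ a → if a ≡ᵇ j then f 0 else 0) π0≡σ0
  ... | inj₂ f0≡0  rewrite f0≡0 = trans (if-0 (π 0 ≡ᵇ j)) (sym (if-0 (σ 0 ≡ᵇ j)))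

push-+ : ∀ L π f h j → push π (λ k → f k + h k) L j ≡ push π f L j + push π h L j
push-+ zero    π f h j = refl
push-+ (suc L) π f h j =
  trans (cong₂ _+_ (if-+ (π 0 ≡ᵇ j) (f 0) (h 0)) (push-+ L (π ∘ suc) (f ∘ suc) (h ∘ suc) j))
        (interchange +-commutativeSemigroup (if π 0 ≡ᵇ j then f 0 else 0) (if π 0 ≡ᵇ j then h 0 else 0) _ _)

push-* : ∀ L π c f j → push π (λ k → c * f k) L j ≡ c * push π f L j
push-* zero    π c f j = sym (*-zeroʳ c)
push-* (suc L) π c f j =
  trans (cong₂ _+_ (if-* (π 0 ≡ᵇ j) c (f 0)) (push-* L (π ∘ suc) c (f ∘ suc) j))
        (sym (*-distribˡ-+ c _ _))

push-vanish : ∀ L π f j → (∀ k → k < L → π k ≡ j → f k ≡ 0) → push π f L j ≡ 0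
push-vanish zero    π f j _  = refl
push-vanish (suc L) π f j f0 = cong₂ _+_ head (push-vanish L (π ∘ suc) (f ∘ suc) j (λ k k<L → f0 (suc k) (s≤s k<L)))
  where
  head : (if π 0 ≡ᵇ j then f 0 else 0) ≡ 0
  head with π 0 ≟ j
  ... | yes π0≡j = trans (if-≡ (f 0) π0≡j) (f0 0 (s≤s z≤n) π0≡j)
  ... | no  π0≢j = if-≢ (f 0) π0≢j

push-hit : ∀ L π f {k} → StrictInc π → k < L → push π f L (π k) ≡ f k
push-hit (suc L) π f {zero} π↑ _ =
  trans (cong₂ _+_ (if-≡ {π 0} (f 0) refl) others) (+-identityʳ (f 0))
  where
  others : push (π ∘ suc) (f ∘ suc) L (π 0) ≡ 0
  others = push-vanish L (π ∘ suc) (f ∘ suc) (π 0)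
             (λ i _ π1+i≡π0 → ⊥-elim (<-irrefl (sym π1+i≡π0) (π↑ 0 (suc i) (s≤s z≤n))))
push-hit (suc L) π f {suc k} π↑ (s≤s k<L) =
  trans (cong (_+ push (π ∘ suc) (f ∘ suc) L (π (suc k)))
              (if-≢ (f 0) (<⇒≢ (π↑ 0 (suc k) (s≤s z≤n)))))
        (push-hit L (π ∘ suc) (f ∘ suc) (λ i j i<j → π↑ (suc i) (suc j) (s≤s i<j)) k<L)

push-extend : ∀ L L′ π f j → VanishesFrom L f → L ≤ L′ → push π f L′ j ≡ push π f L j
push-extend zero    L′       π f j f0 _         = push-vanish L′ π f j (λ k _ _ → f0 k z≤n)
push-extend (suc L) (suc L′) π f j f0 (s≤s L≤L′) =
  cong (_ +_) (push-extend L L′ (π ∘ suc) (f ∘ suc) j (λ k L≤k → f0 (suc k) (s≤s L≤k)) L≤L′)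

push-length : ∀ L L′ π f → VanishesFrom L f → VanishesFrom L′ f → push π f L ≗ push π f L′
push-length L L′ π f f0 f0′ j =
  trans (sym (push-extend L (L + L′) π f j f0 (m≤m+n L L′))) (push-extend L′ (L + L′) π f j f0′ (m≤n+m L′ L))

push-delta : ∀ N σ {b} c j → b < N → push σ (λ i → if b ≡ᵇ i then c else 0) N j ≡ (if σ b ≡ᵇ j then c else 0)
push-delta (suc N) σ {zero}  c j _ =
  trans (cong (_ +_) (push-vanish N (σ ∘ suc) _ j (λ _ _ _ → refl))) (+-identityʳ _)
push-delta (suc N) σ {suc b} c j (s≤s b<N) =
  cong₂ _+_ (if-0 (σ 0 ≡ᵇ j)) (push-delta N (σ ∘ suc) c j b<N)

push-∘ : ∀ L σ ρ g N j → (∀ k → k < L → N ≤ ρ k → g k ≡ 0) →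
  push σ (λ i → push ρ g L i) N j ≡ push (σ ∘ ρ) g L j
push-∘ zero    σ ρ g N j _  = push-vanish N σ _ j (λ _ _ _ → refl)
push-∘ (suc L) σ ρ g N j g0 =
  trans (push-+ N σ _ _ j)
        (cong₂ _+_ head (push-∘ L σ (ρ ∘ suc) (g ∘ suc) N j (λ k k<L → g0 (suc k) (s≤s k<L))))
  where
  head : push σ (λ i → if ρ 0 ≡ᵇ i then g 0 else 0) N j ≡ (if σ (ρ 0) ≡ᵇ j then g 0 else 0)
  head with ρ 0 <? N
  ... | yes ρ0<N = push-delta N σ (g 0) j ρ0<N
  ... | no  ρ0≮N rewrite g0 0 (s≤s z≤n) (≮⇒≥ ρ0≮N) =
    trans (push-vanish N σ _ j (λ k _ _ → if-0 (ρ 0 ≡ᵇ k))) (sym (if-0 _))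

push-id : ∀ L f → VanishesFrom L f → push id f L ≗ f
push-id L f f0 j with j <? L
... | yes j<L = push-hit L id f (λ _ _ i<j → i<j) j<L
... | no  j≮L = trans (push-vanish L id f j (λ k k<L k≡j → ⊥-elim (j≮L (subst (_< L) k≡j k<L))))
                      (sym (f0 j (≮⇒≥ j≮L)))

StrictInc-≥ : ∀ {π} → StrictInc π → ∀ k → k ≤ π k
StrictInc-≥ π↑ zero    = z≤n
StrictInc-≥ π↑ (suc k) = <-≤-trans (s≤s (StrictInc-≥ π↑ k)) (π↑ k (suc k) ≤-refl)

StrictInc-∘ : ∀ {σ τ} → StrictInc σ → StrictInc τ → StrictInc (σ ∘ τ)
StrictInc-∘ σ↑ τ↑ i j i<j = σ↑ _ _ (τ↑ i j i<j)

StrictInc-reflects-< : ∀ {π} → StrictInc π → ∀ {i j} → π i < π j → i < j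
StrictInc-reflects-< {π} π↑ {i} {j} πi<πj with <-cmp i j
... | tri< i<j _ _ = i<j
... | tri≈ _ refl _ = ⊥-elim (<-irrefl refl πi<πj)
... | tri> _ _ j<i = ⊥-elim (<-asym πi<πj (π↑ j i j<i))

InIncMN⇒≤ : ∀ {m n π} → InIncMN m n π → m ≤ n
InIncMN⇒≤ {zero}  _          = z≤n
InIncMN⇒≤ {suc m} (π↑ , π<n) = <-≤-trans (s≤s (StrictInc-≥ π↑ m)) (π<n m ≤-refl)

InIncMN-id : ∀ {m n} → m ≤ n → InIncMN m n id
InIncMN-id m≤n = (λ _ _ i<j → i<j) , (λ k k<m → <-≤-trans k<m m≤n)

InIncMN-∘ : ∀ {m n N σ τ} → InIncMN n N σ → InIncMN m n τ → InIncMN m N (σ ∘ τ)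
InIncMN-∘ (σ↑ , σ<N) (τ↑ , τ<n) = StrictInc-∘ σ↑ τ↑ , (λ k k<m → σ<N _ (τ<n k k<m))

actCoord-push : ∀ {m} π (u : Vec ℕ m) j → actCoord π u j ≡ push π (coord u) m j
actCoord-push π []      j = refl
actCoord-push π (x ∷ u) j = cong (_ +_) (actCoord-push (π ∘ suc) u j)

coord-act : ∀ {m} π (u : Vec ℕ m) n {j} → j < n → coord (act π u n) j ≡ push π (coord u) m j
coord-act π u n j<n = trans (coord-tabulate-< n (actCoord π u) j<n) (actCoord-push π u _)

coord-act-inc : ∀ {m n π} (u : Vec ℕ m) → InIncMN m n π → coord (act π u n) ≗ push π (coord u) m
coord-act-inc {m} {n} {π} u (_ , π<n) j with j <? n
... | yes j<n = coord-act π u n j<n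
... | no  j≮n = trans (coord-vanishes (act π u n) j (≮⇒≥ j≮n))
  (sym (push-vanish m π (coord u) j (λ k k<m πk≡j → ⊥-elim (j≮n (subst (_< n) πk≡j (π<n k k<m))))))

coord-act-id : ∀ {m n} (w : Vec ℕ m) → m ≤ n → coord (act id w n) ≗ coord w
coord-act-id {m} w m≤n j = trans (coord-act-inc w (InIncMN-id m≤n) j) (push-id m (coord w) (coord-vanishes w) j)

act-id : ∀ {n} (x : Vec ℕ n) → act id x n ≡ x
act-id x = coord-ext λ j _ → coord-act-id x ≤-refl j

act-∘ : ∀ {m n} σ {τ} N (w : Vec ℕ m) → InIncMN m n τ → act σ (act τ w n) N ≡ act (σ ∘ τ) w N
act-∘ {m} {n} σ {τ} N w τ-inc@(_ , τ<n) = coord-ext λ j j<N → begin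
  coord (act σ (act τ w n) N) j      ≡⟨ coord-act σ (act τ w n) N j<N ⟩
  push σ (coord (act τ w n)) n j     ≡⟨ push-cong n σ j (λ i _ → coord-act-inc w τ-inc i) ⟩
  push σ (push τ (coord w) m) n j    ≡⟨ push-∘ m σ τ (coord w) n j (λ k k<m n≤τk → ⊥-elim (<⇒≱ (τ<n k k<m) n≤τk)) ⟩
  push (σ ∘ τ) (coord w) m j         ≡⟨ coord-act (σ ∘ τ) w N j<N ⟨
  coord (act (σ ∘ τ) w N) j          ∎
  where open ≡-Reasoning

act-replicate-0 : ∀ {m} π n → act π (replicate m 0) n ≡ replicate n 0
act-replicate-0 {m} π n = coord-ext λ j j<n →
  trans (coord-act π (replicate m 0) n j<n)
        (trans (push-vanish m π _ j (λ k _ _ → coord-replicate-0 m k)) (sym (coord-replicate-0 n j)))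

act-+ᵥ : ∀ {m} π n (x y : Vec ℕ m) → act π (x +ᵥ y) n ≡ act π x n +ᵥ act π y n
act-+ᵥ {m} π n x y = coord-ext λ j j<n → begin
  coord (act π (x +ᵥ y) n) j                            ≡⟨ coord-act π (x +ᵥ y) n j<n ⟩
  push π (coord (x +ᵥ y)) m j                           ≡⟨ push-cong m π j (λ k _ → coord-+ᵥ x y k) ⟩
  push π (λ k → coord x k + coord y k) m j              ≡⟨ push-+ m π (coord x) (coord y) j ⟩
  push π (coord x) m j + push π (coord y) m j           ≡⟨ cong₂ _+_ (coord-act π x n j<n) (coord-act π y n j<n) ⟨
  coord (act π x n) j + coord (act π y n) j             ≡⟨ coord-+ᵥ (act π x n) (act π y n) j ⟨
  coord (act π x n +ᵥ act π y n) j                      ∎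
  where open ≡-Reasoning

act-⋆ : ∀ {m} π n c (x : Vec ℕ m) → act π (c ⋆ x) n ≡ c ⋆ act π x n
act-⋆ {m} π n c x = coord-ext λ j j<n → begin
  coord (act π (c ⋆ x) n) j        ≡⟨ coord-act π (c ⋆ x) n j<n ⟩
  push π (coord (c ⋆ x)) m j       ≡⟨ push-cong m π j (λ k _ → coord-⋆ c x k) ⟩
  push π (λ k → c * coord x k) m j ≡⟨ push-* m π c (coord x) j ⟩
  c * push π (coord x) m j         ≡⟨ cong (c *_) (coord-act π x n j<n) ⟨
  c * coord (act π x n) j          ≡⟨ coord-⋆ c (act π x n) j ⟨
  coord (c ⋆ act π x n) j          ∎
  where open ≡-Reasoning

module _ {n : ℕ} where

  Mon-zero : ∀ (A : Subset n) → Mon A (replicate n 0)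
  Mon-zero A = [] , [] , refl

  Mon-single : ∀ {A : Subset n} {x} → A x → Mon A x
  Mon-single {x = x} Ax = (1 , x) ∷ [] , Ax ∷ [] , coord-ext λ i _ →
    sym (trans (coord-lincomb-∷ 1 x [] i) (trans (cong₂ _+_ (*-identityˡ _) (coord-replicate-0 n i)) (+-identityʳ _)))

  Mon-mono : ∀ {A B : Subset n} → (∀ {x} → A x → B x) → ∀ {x} → Mon A x → Mon B x
  Mon-mono A⊆B (l , Al , refl) = l , All.map A⊆B Al , refl

  lincomb-++ : ∀ (l l′ : List (ℕ × Vec ℕ n)) → lincomb (l ++ l′) ≡ lincomb l +ᵥ lincomb l′
  lincomb-++ l l′ = coord-ext λ i _ → trans (go l i) (sym (coord-+ᵥ (lincomb l) (lincomb l′) i))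
    where
    go : ∀ l i → coord (lincomb (l ++ l′)) i ≡ coord (lincomb l) i + coord (lincomb l′) i
    go []            i = cong (_+ coord (lincomb l′) i) (sym (coord-replicate-0 n i))
    go ((c , a) ∷ l) i = begin
      coord (lincomb ((c , a) ∷ l ++ l′)) i                     ≡⟨ coord-lincomb-∷ c a (l ++ l′) i ⟩
      c * coord a i + coord (lincomb (l ++ l′)) i               ≡⟨ cong (c * coord a i +_) (go l i) ⟩
      c * coord a i + (coord (lincomb l) i + coord (lincomb l′) i) ≡⟨ +-assoc (c * coord a i) _ _ ⟨
      (c * coord a i + coord (lincomb l) i) + coord (lincomb l′) i ≡⟨ cong (_+ coord (lincomb l′) i) (coord-lincomb-∷ c a l i) ⟨
      coord (lincomb ((c , a) ∷ l)) i + coord (lincomb l′) i    ∎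
      where open ≡-Reasoning

  Mon-+ᵥ : ∀ {A : Subset n} {x y} → Mon A x → Mon A y → Mon A (x +ᵥ y)
  Mon-+ᵥ (l , Al , refl) (l′ , Al′ , refl) = l ++ l′ , AllP.++⁺ Al Al′ , sym (lincomb-++ l l′)

  Mon-⋆ : ∀ {A : Subset n} c {x} → Mon A x → Mon A (c ⋆ x)
  Mon-⋆ zero    {x} _   = subst (Mon _) (coord-ext λ i _ →
    trans (coord-replicate-0 n i) (sym (coord-⋆ 0 x i))) (Mon-zero _)
  Mon-⋆ (suc c) {x} Ax = subst (Mon _) (coord-ext λ i _ →
    trans (coord-+ᵥ x (c ⋆ x) i) (trans (cong (coord x i +_) (coord-⋆ c x i)) (sym (coord-⋆ (suc c) x i))))
    (Mon-+ᵥ Ax (Mon-⋆ c Ax))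

  Mon-idem : ∀ {A : Subset n} {x} → Mon (Mon A) x → Mon A x
  Mon-idem (l , Al , refl) = go l Al
    where
    go : ∀ l → All (λ p → Mon _ (proj₂ p)) l → Mon _ (lincomb l)
    go []            []          = Mon-zero _
    go ((c , a) ∷ l) (MAa ∷ MAl) = Mon-+ᵥ (Mon-⋆ c MAa) (go l MAl)

Mon-linear : ∀ {m n} {A : Subset m} {B : Subset n} (f : Vec ℕ m → Vec ℕ n) →
  f (replicate m 0) ≡ replicate n 0 → (∀ x y → f (x +ᵥ y) ≡ f x +ᵥ f y) → (∀ c x → f (c ⋆ x) ≡ c ⋆ f x) →
  (∀ {x} → A x → B (f x)) → ∀ {x} → Mon A x → Mon B (f x)
Mon-linear {A = A} {B} f f0 f+ f⋆ A⇒B (l , Al , refl) = go l Al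
  where
  go : ∀ l → All (λ p → A (proj₂ p)) l → Mon B (f (lincomb l))
  go []            []        = subst (Mon B) (sym f0) (Mon-zero B)
  go ((c , a) ∷ l) (Aa ∷ Al) = subst (Mon B) (sym (trans (f+ _ _) (cong (_+ᵥ f (lincomb l)) (f⋆ c a))))
    (Mon-+ᵥ (Mon-⋆ c (Mon-single (A⇒B Aa))) (go l Al))

Mon-act : ∀ {m n} {A : Subset m} {B : Subset n} π → (∀ {x} → A x → B (act π x n)) →
  ∀ {x} → Mon A x → Mon B (act π x n)
Mon-act {m} {n} π = Mon-linear (λ x → act π x n) (act-replicate-0 {m} π n) (act-+ᵥ π n) (act-⋆ π n)

Mon-restrict : ∀ {N} n {A : Subset N} {B : Subset n} →
  (∀ {a} → A a → VanishesFrom n (coord a) → B (padTo n a)) →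
  ∀ {v} → Mon A v → VanishesFrom n (coord v) → Mon B (padTo n v)
Mon-restrict {N} n {A} {B} A⇒B (l , Al , refl) = go l Al
  where
  go : ∀ l → All (λ p → A (proj₂ p)) l → VanishesFrom n (coord (lincomb l)) → Mon B (padTo n (lincomb l))
  go [] [] _ = subst (Mon B) (coord-ext λ i i<n →
    trans (coord-replicate-0 n i) (sym (trans (coord-padTo-< n (replicate N 0) i<n) (coord-replicate-0 N i)))) (Mon-zero B)
  go ((c , a) ∷ l) (Aa ∷ Al) v0 with c
  ... | zero   = subst (Mon B) (coord-ext λ i i<n →
    trans (coord-padTo-< n (lincomb l) i<n)
          (sym (trans (coord-padTo-< n (lincomb ((0 , a) ∷ l)) i<n) (coord-lincomb-∷ 0 a l i))))
    (go l Al rest0)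
    where
    rest0 : VanishesFrom n (coord (lincomb l))
    rest0 k n≤k = trans (sym (coord-lincomb-∷ 0 a l k)) (v0 k n≤k)
  ... | suc c′ = subst (Mon B) (sym (padTo-lincomb-∷ n (suc c′) a l))
    (Mon-+ᵥ (Mon-⋆ (suc c′) (Mon-single (A⇒B Aa a0))) (go l Al rest0))
    where
    both0 : ∀ k → n ≤ k → suc c′ * coord a k + coord (lincomb l) k ≡ 0
    both0 k n≤k = trans (sym (coord-lincomb-∷ (suc c′) a l k)) (v0 k n≤k)
    a0 : VanishesFrom n (coord a)
    a0 k n≤k = m+n≡0⇒m≡0 (coord a k) (m+n≡0⇒m≡0 (suc c′ * coord a k) (both0 k n≤k))
    rest0 : VanishesFrom n (coord (lincomb l))
    rest0 k n≤k = m+n≡0⇒n≡0 (suc c′ * coord a k) (both0 k n≤k)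

punchIn : ℕ → ℕ → ℕ
punchIn zero    i       = suc i
punchIn (suc a) zero    = zero
punchIn (suc a) (suc i) = suc (punchIn a i)

punchIn-≤ : ∀ a i → punchIn a i ≤ suc i
punchIn-≤ zero    i       = ≤-refl
punchIn-≤ (suc a) zero    = z≤n
punchIn-≤ (suc a) (suc i) = s≤s (punchIn-≤ a i)

punchIn-≥ : ∀ {a i} → a ≤ i → punchIn a i ≡ suc i
punchIn-≥ {zero}            _         = refl
punchIn-≥ {suc a} {suc i} (s≤s a≤i) = cong suc (punchIn-≥ a≤i)

punchIn-strict : ∀ a → StrictInc (punchIn a)
punchIn-strict zero    i       j       i<j       = s≤s i<j
punchIn-strict (suc a) zero    (suc j) _         = s≤s z≤n
punchIn-strict (suc a) (suc i) (suc j) (s≤s i<j) = s≤s (punchIn-strict a i j i<j)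

InIncMN-punchIn : ∀ a n → InIncMN n (suc n) (punchIn a)
InIncMN-punchIn a n = punchIn-strict a , λ k k<n → s≤s (≤-trans (punchIn-≤ a k) k<n)

punchOut : ℕ → ℕ → ℕ
punchOut zero    j       = pred j
punchOut (suc a) zero    = zero
punchOut (suc a) (suc j) = suc (punchOut a j)

punchIn-punchOut : ∀ {a j} → j ≢ a → punchIn a (punchOut a j) ≡ j
punchIn-punchOut {zero}  {zero}  0≢0 = ⊥-elim (0≢0 refl)
punchIn-punchOut {zero}  {suc j} _   = refl
punchIn-punchOut {suc a} {zero}  _   = refl
punchIn-punchOut {suc a} {suc j} j≢a = cong suc (punchIn-punchOut (j≢a ∘ cong suc))

-- A value a missed by π lets π factor as punchIn a ∘ (punchOut a ∘ π).
fixes-or-misses : ∀ {π} → StrictInc π → ∀ n →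
  (∀ k → k < n → π k ≡ k) ⊎ (Σ ℕ λ a → a < n × ∀ k → π k ≢ a)
fixes-or-misses π↑ zero = inj₁ (λ k ())
fixes-or-misses {π} π↑ (suc n) with fixes-or-misses π↑ n
... | inj₂ (a , a<n , misses-a) = inj₂ (a , m<n⇒m<1+n a<n , misses-a)
... | inj₁ fix with π n ≟ n
...   | yes πn≡n = inj₁ λ k k<1+n → [ fix k , (λ { refl → πn≡n }) ]′ (m<1+n⇒m<n∨m≡n k<1+n)
...   | no  πn≢n = inj₂ (n , ≤-refl , misses-n)
  where
  misses-n : ∀ k → π k ≢ n
  misses-n k πk≡n with <-cmp k n
  ... | tri< k<n _ _  = <-irrefl (trans (sym (fix k k<n)) πk≡n) k<n
  ... | tri≈ _ refl _ = πn≢n πk≡n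
  ... | tri> _ _ n<k  = <-irrefl (sym πk≡n) (<-≤-trans n<k (StrictInc-≥ π↑ k))

-- x lies in the Inc-orbit of the element g of ℤ^q, both read in ℤ^(ℕ); π is free where g vanishes.
record InOrbit (p : Σ ℕ (Vec ℕ)) {n} (x : Vec ℕ n) : Set where
  constructor orbit
  field
    π      : ℕ → ℕ
    strict : StrictInc π
    coords : coord x ≗ push π (coord (proj₂ p)) (proj₁ p)

orbit-self : ∀ {q} {g : Vec ℕ q} {n} {x : Vec ℕ n} → coord x ≗ coord g → InOrbit (q , g) x
orbit-self {q} {g} x≗g = orbit id (λ _ _ i<j → i<j) λ j → trans (x≗g j) (sym (push-id q (coord g) (coord-vanishes g) j))

orbit-coord : ∀ {q n} (g : Vec ℕ q) (x : Vec ℕ n) {π} → StrictInc π → coord x ≗ push π (coord g) q →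
  ∀ {k} → k < q → coord g k ≡ coord x (π k)
orbit-coord {q} g x {π} π↑ x≗ k<q = trans (sym (push-hit q π (coord g) π↑ k<q)) (sym (x≗ _))

orbit-act : ∀ {p m n τ} {u : Vec ℕ m} → InIncMN m n τ → InOrbit p u → InOrbit p (act τ u n)
orbit-act {q , g} {m} {n} {τ} {u} τ-inc@(τ↑ , _) (orbit π π↑ u≗) = orbit (τ ∘ π) (StrictInc-∘ τ↑ π↑) λ j → begin
  coord (act τ u n) j                 ≡⟨ coord-act-inc u τ-inc j ⟩
  push τ (coord u) m j                ≡⟨ push-cong m τ j (λ i _ → u≗ i) ⟩
  push τ (push π (coord g) q) m j     ≡⟨ push-∘ q τ π (coord g) m j g0 ⟩
  push (τ ∘ π) (coord g) q j          ∎
  where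
  open ≡-Reasoning
  g0 : ∀ k → k < q → m ≤ π k → coord g k ≡ 0
  g0 k k<q m≤πk = trans (orbit-coord g u π↑ u≗ k<q) (coord-vanishes u (π k) m≤πk)

orbit-padTo : ∀ {p N} n {w : Vec ℕ N} → InOrbit p w → VanishesFrom n (coord w) → InOrbit p (padTo n w)
orbit-padTo n {w} (orbit π π↑ w≗) w0 = orbit π π↑ λ j → trans (coord-padTo n w w0 j) (w≗ j)

orbit-fixed : ∀ {q n} (g : Vec ℕ q) (x : Vec ℕ n) {π} → StrictInc π → coord x ≗ push π (coord g) q →
  (∀ k → k < n → π k ≡ k) → coord x ≗ coord g
orbit-fixed {q} {n} g x {π} π↑ x≗ fix j = begin
  coord x j             ≡⟨ x≗ j ⟩
  push π (coord g) q j  ≡⟨ push-congˡ q (coord g) j π≈id ⟩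
  push id (coord g) q j ≡⟨ push-id q (coord g) (coord-vanishes g) j ⟩
  coord g j             ∎
  where
  open ≡-Reasoning
  π≈id : ∀ k → k < q → π k ≡ k ⊎ coord g k ≡ 0
  π≈id k k<q with k <? n
  ... | yes k<n = inj₁ (fix k k<n)
  ... | no  k≮n = inj₂ (trans (orbit-coord g x π↑ x≗ k<q) (coord-vanishes x (π k) (≤-trans (≮⇒≥ k≮n) (StrictInc-≥ π↑ k))))

orbit-peel : ∀ {q} {g : Vec ℕ q} {n} {x : Vec ℕ (suc n)} → InOrbit (q , g) x →
  coord x ≗ coord g ⊎
  (Σ ℕ λ a → a < suc n × Σ (Vec ℕ n) λ u → InOrbit (q , g) u × x ≡ act (punchIn a) u (suc n))
orbit-peel {q} {g} {n} {x} (orbit π π↑ x≗) with fixes-or-misses π↑ (suc n)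
... | inj₁ fix = inj₁ (orbit-fixed g x π↑ x≗ fix)
... | inj₂ (a , a<1+n , misses-a) = inj₂ (a , a<1+n , u , orbit ρ ρ↑ u≗ , x≡)
  where
  ρ : ℕ → ℕ
  ρ = punchOut a ∘ π
  π≡ : ∀ k → punchIn a (ρ k) ≡ π k
  π≡ k = punchIn-punchOut (misses-a k)
  ρ↑ : StrictInc ρ
  ρ↑ i j i<j = StrictInc-reflects-< (punchIn-strict a) (subst₂ _<_ (sym (π≡ i)) (sym (π≡ j)) (π↑ i j i<j))
  g0 : ∀ k → k < q → n ≤ ρ k → coord g k ≡ 0
  g0 k k<q n≤ρk = trans (orbit-coord g x π↑ x≗ k<q) (coord-vanishes x (π k) 1+n≤πk)
    where
    1+n≤πk : suc n ≤ π k
    1+n≤πk = subst (suc n ≤_) (trans (sym (punchIn-≥ (≤-trans (≤-pred a<1+n) n≤ρk))) (π≡ k)) (s≤s n≤ρk)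
  u : Vec ℕ n
  u = tabulate (push ρ (coord g) q ∘ toℕ)
  u≗ : coord u ≗ push ρ (coord g) q
  u≗ = coord-tabulate n λ j n≤j → push-vanish q ρ (coord g) j λ k k<q ρk≡j → g0 k k<q (subst (n ≤_) (sym ρk≡j) n≤j)
  x≡ : x ≡ act (punchIn a) u (suc n)
  x≡ = coord-ext λ j j<1+n → begin
    coord x j                                  ≡⟨ x≗ j ⟩
    push π (coord g) q j                       ≡⟨ push-congˡ q (coord g) j (λ k _ → inj₁ (sym (π≡ k))) ⟩
    push (punchIn a ∘ ρ) (coord g) q j         ≡⟨ push-∘ q (punchIn a) ρ (coord g) n j g0 ⟨
    push (punchIn a) (push ρ (coord g) q) n j  ≡⟨ push-cong n (punchIn a) j (λ i _ → u≗ i) ⟨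
    push (punchIn a) (coord u) n j             ≡⟨ coord-act (punchIn a) u (suc n) j<1+n ⟨
    coord (act (punchIn a) u (suc n)) j        ∎
    where open ≡-Reasoning

orbit-factor : ∀ {q} {g : Vec ℕ q} {m} n {x : Vec ℕ n} → q ≤ m → m ≤ n → InOrbit (q , g) x →
  Σ (ℕ → ℕ) λ τ → InIncMN m n τ × Σ (Vec ℕ m) λ w → InOrbit (q , g) w × x ≡ act τ w n
orbit-factor n {x} q≤m m≤n x∈ with m≤n⇒m<n∨m≡n m≤n
... | inj₂ refl = id , InIncMN-id ≤-refl , x , x∈ , sym (act-id x)
orbit-factor {q} {g} {m} (suc n) {x} q≤m _ x∈ | inj₁ (s≤s m≤n) with orbit-peel x∈
... | inj₁ x≗g = id , InIncMN-id (m≤n⇒m≤1+n m≤n) , padTo m g , orbit-self g′≗g , coord-ext λ j _ →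
  trans (x≗g j) (sym (trans (coord-act-id (padTo m g) (m≤n⇒m≤1+n m≤n) j) (g′≗g j)))
  where
  g′≗g : coord (padTo m g) ≗ coord g
  g′≗g = coord-padTo m g (vanishesFrom-mono q≤m (coord-vanishes g))
... | inj₂ (a , _ , u , u∈ , x≡) with orbit-factor n q≤m m≤n u∈
...   | τ , τ-inc , w , w∈ , u≡ = punchIn a ∘ τ , InIncMN-∘ (InIncMN-punchIn a n) τ-inc , w , w∈ ,
  trans x≡ (trans (cong (λ v → act (punchIn a) v (suc n)) u≡) (act-∘ (punchIn a) (suc n) w τ-inc))

vanishesFrom? : ∀ n {q} (v : Vec ℕ q) → Dec (VanishesFrom n (coord v))
vanishesFrom? n       []      = yes λ _ _ → refl
vanishesFrom? zero    (x ∷ v) with x ≟ 0 | vanishesFrom? zero v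
... | yes x≡0 | yes v0 = yes λ { zero _ → x≡0 ; (suc k) _ → v0 k z≤n }
... | no  x≢0 | _      = no λ x∷v0 → x≢0 (x∷v0 0 z≤n)
... | _       | no ¬v0 = no λ x∷v0 → ¬v0 λ k _ → x∷v0 (suc k) z≤n
vanishesFrom? (suc n) (x ∷ v) with vanishesFrom? n v
... | yes v0 = yes λ { (suc k) (s≤s n≤k) → v0 k n≤k }
... | no ¬v0 = no λ x∷v0 → ¬v0 λ k n≤k → x∷v0 (suc k) (s≤s n≤k)

-- The orbit element of ℤ^n that π = id contributes, if g fits into ℤ^n.
fitting : Σ ℕ (Vec ℕ) → (n : ℕ) → List (Vec ℕ n)
fitting (q , g) n with vanishesFrom? n g
... | yes _ = padTo n g ∷ []
... | no  _ = []

fitting-sound : ∀ {p n x} → x ∈ fitting p n → InOrbit p x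
fitting-sound {q , g} {n} x∈ with vanishesFrom? n g
fitting-sound {q , g} {n} (here refl) | yes g0 = orbit-self (coord-padTo n g g0)

fitting-complete : ∀ {q} {g : Vec ℕ q} {n} {x : Vec ℕ n} → coord x ≗ coord g → x ∈ fitting (q , g) n
fitting-complete {q} {g} {n} {x} x≗g with vanishesFrom? n g
... | yes g0  = here (coord-ext λ j _ → trans (x≗g j) (sym (coord-padTo n g g0 j)))
... | no  ¬g0 = ⊥-elim (¬g0 λ k n≤k → trans (sym (x≗g k)) (coord-vanishes x k n≤k))

-- Inc(g) ∩ ℤ^n, enumerated by recursion on n: an orbit element of ℤ^(n+1) is g itself or
-- punchIn a applied to an orbit element of ℤ^n (orbit-peel).
orbitList : Σ ℕ (Vec ℕ) → (n : ℕ) → List (Vec ℕ n)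
orbitList p zero    = fitting p zero
orbitList p (suc n) = fitting p (suc n) ++
  cartesianProductWith (λ a u → act (punchIn a) u (suc n)) (upTo (suc n)) (orbitList p n)

orbitList-sound : ∀ {p} n {x} → x ∈ orbitList p n → InOrbit p x
orbitList-sound zero    x∈ = fitting-sound x∈
orbitList-sound {p} (suc n) x∈ with ∈-++⁻ (fitting p (suc n)) x∈
... | inj₁ x∈fitting = fitting-sound x∈fitting
... | inj₂ x∈shifted with ∈-cartesianProductWith⁻ _ (upTo (suc n)) (orbitList p n) x∈shifted
...   | a , u , _ , u∈ , refl = orbit-act (InIncMN-punchIn a n) (orbitList-sound n u∈)

orbitList-complete : ∀ {p} n {x} → InOrbit p x → x ∈ orbitList p n
orbitList-complete {q , g} zero {x} (orbit π π↑ x≗) = fitting-complete (orbit-fixed g x π↑ x≗ λ k ())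
orbitList-complete {p@(q , g)} (suc n) x∈ with orbit-peel x∈
... | inj₁ x≗g = ∈-++⁺ˡ (fitting-complete {g = g} x≗g)
... | inj₂ (a , a<1+n , u , u∈ , refl) = ∈-++⁺ʳ (fitting p (suc n))
  (∈-cartesianProductWith⁺ (λ a u → act (punchIn a) u (suc n)) (∈-upTo⁺ a<1+n) (orbitList-complete n u∈))

module IncInvariantChain (M : Chain) (inv : IsIncInvariantChainOfMonoids M) where

  M-closed : ∀ n {v} → Mon (M n) v → M n v
  M-closed n = proj₁ inv n _

  M-padTo : ∀ {N} N′ {w : Vec ℕ N} → N ≤ N′ → M N w → M N′ (padTo N′ w)
  M-padTo N′ {w} N≤N′ Mw with m≤n⇒m<n∨m≡n N≤N′
  ... | inj₂ refl = subst (M N′) (sym (padTo-self w)) Mw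
  M-padTo (suc N′) {w} _ Mw | inj₁ (s≤s N≤N′) =
    subst (M (suc N′)) (padTo-padTo (suc N′) N′ w N≤N′) (proj₁ (proj₂ inv) N′ _ (M-padTo N′ N≤N′ Mw))

  -- For m > n the set Inc_{m,n} is empty, so only 0 is generated.
  Mon-IncImage⊆M : ∀ m n {v} → Mon (IncImage M m n) v → M n v
  Mon-IncImage⊆M m n with m ≤? n
  ... | yes m≤n = proj₂ (proj₂ inv) m n m≤n _
  ... | no  m≰n = M-closed n ∘ Mon-mono λ (_ , π-inc , _) → ⊥-elim (m≰n (InIncMN⇒≤ π-inc))

  InLimit : (ℕ → ℕ) → Set
  InLimit f = Σ ℕ λ N → Σ (Vec ℕ N) λ w → M N w × coord w ≗ f

  MInf⇒InLimit : ∀ {n} {v : Vec ℕ n} → MInf M n v → InLimit (coord v)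
  MInf⇒InLimit {v = v} (N , n≤N , Mv) = N , padTo N v , Mv , coord-padTo N v (vanishesFrom-mono n≤N (coord-vanishes v))

  InLimit⇒MInf : ∀ {n} {v : Vec ℕ n} → InLimit (coord v) → MInf M n v
  InLimit⇒MInf {n} {v} (N , w , Mw , w≗v) = N + n , m≤n+m n N ,
    subst (M (N + n)) (coord-ext λ i i<N+n → trans (coord-padTo-< (N + n) w i<N+n) (trans (w≗v i) (sym (coord-padTo-< (N + n) v i<N+n))))
      (M-padTo (N + n) (m≤m+n N n) Mw)

  InLimit-orbit : ∀ {q} {g : Vec ℕ q} {n} {x : Vec ℕ n} → InLimit (coord g) → InOrbit (q , g) x → InLimit (coord x)
  InLimit-orbit {q} {g} {n} {x} (N , w , Mw , w≗g) (orbit π π↑ x≗) = π N , act π w (π N) , Mπw , λ j → begin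
    coord (act π w (π N)) j ≡⟨ coord-act-inc w π-inc j ⟩
    push π (coord w) N j    ≡⟨ push-cong N π j (λ k _ → w≗g k) ⟩
    push π (coord g) N j    ≡⟨ push-length N q π (coord g) g0 (coord-vanishes g) j ⟩
    push π (coord g) q j    ≡⟨ x≗ j ⟨
    coord x j               ∎
    where
    open ≡-Reasoning
    π-inc : InIncMN N (π N) π
    π-inc = π↑ , λ k k<N → π↑ k N k<N
    Mπw : M (π N) (act π w (π N))
    Mπw = Mon-IncImage⊆M N (π N) (Mon-single (π , π-inc , w , Mw , refl))
    g0 : VanishesFrom N (coord g)
    g0 k N≤k = trans (sym (w≗g k)) (coord-vanishes w k N≤k)

  MInf-orbit : ∀ {q} {g : Vec ℕ q} {n} {x : Vec ℕ n} → MInf M q g → InOrbit (q , g) x → MInf M n x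
  MInf-orbit {g = g} {x = x} g∈ x∈ = InLimit⇒MInf {v = x} (InLimit-orbit (MInf⇒InLimit {v = g} g∈) x∈)

  a⇒b : CondA M → CondB M
  a⇒b ((r , stable) , (r′ , finGen)) = G , AllP.map⁺ (All.tabulate G⊆M∞) , λ n v → M∞⊆MonIncG {v = v} , MonIncG⊆M∞ {v = v}
    where
    s : ℕ
    s = r + r′
    Gs : List (Vec ℕ s)
    Gs = proj₁ (finGen s (m≤n+m r′ r))
    Gs-generates : ∀ v → (M s v → Mon (_∈ Gs) v) × (Mon (_∈ Gs) v → M s v)
    Gs-generates = proj₂ (finGen s (m≤n+m r′ r))
    G : List (Σ ℕ (Vec ℕ))
    G = map (s ,_) Gs
    Gs⊆M : ∀ {g} → g ∈ Gs → M s g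
    Gs⊆M {g} g∈ = proj₂ (Gs-generates g) (Mon-single g∈)
    G⊆M∞ : ∀ {g} → g ∈ Gs → MInf M s g
    G⊆M∞ {g} g∈ = s , ≤-refl , subst (M s) (sym (padTo-self g)) (Gs⊆M g∈)
    M∞⊆MonIncG : ∀ {n} {v : Vec ℕ n} → MInf M n v → MonIncG G n v
    M∞⊆MonIncG {n} {v} (N , n≤N , Mv) = N + s , ≤-trans n≤N (m≤m+n N s) , Mon-idem (Mon-mono expand Mv′)
      where
      Mv′ : Mon (IncImage M s (N + s)) (padTo (N + s) v)
      Mv′ = proj₂ (stable s (N + s) (m≤m+n r r′) (m≤n+m s N) (padTo (N + s) v))
        (subst (M (N + s)) (padTo-padTo (N + s) N v n≤N) (M-padTo (N + s) (m≤m+n N s) Mv))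
      expand : ∀ {y} → IncImage M s (N + s) y → Mon (IncGImage G (N + s)) y
      expand (π , π-inc , u , Mu , refl) =
        Mon-act π (λ g∈ → (s , _) , ∈-map⁺ (s ,_) g∈ , π , π-inc , refl) (proj₁ (Gs-generates u) Mu)
    MonIncG⊆M∞ : ∀ {n} {v : Vec ℕ n} → MonIncG G n v → MInf M n v
    MonIncG⊆M∞ (N , n≤N , v∈) = N , n≤N , Mon-IncImage⊆M s N (Mon-mono lower v∈)
      where
      lower : ∀ {y} → IncGImage G N y → IncImage M s N y
      lower (_ , p∈ , π , π-inc , y≡) with ∈-map⁻ (s ,_) p∈
      ... | g , g∈ , refl = π , π-inc , g , Gs⊆M g∈ , y≡

  module Saturated {r₀ : ℕ} (saturated : ∀ n → r₀ ≤ n → ∀ v → (M n v → MInf M n v) × (MInf M n v → M n v))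
                   {G : List (Σ ℕ (Vec ℕ))} (G⊆M∞ : All (λ p → MInf M (proj₁ p) (proj₂ p)) G)
                   (M∞≡MonIncG : ∀ n v → (MInf M n v → MonIncG G n v) × (MonIncG G n v → MInf M n v)) where

    R : ℕ
    R = max r₀ (map proj₁ G)
    r₀≤R : r₀ ≤ R
    r₀≤R = ⊥≤max r₀ (map proj₁ G)
    length≤R : ∀ {p} → p ∈ G → proj₁ p ≤ R
    length≤R p∈ = All.lookup (xs≤max r₀ (map proj₁ G)) (∈-map⁺ proj₁ p∈)

    Orbits : ∀ n → Subset n
    Orbits n x = Σ (Σ ℕ (Vec ℕ)) λ p → p ∈ G × InOrbit p x

    Orbits⊆M : ∀ {n} → r₀ ≤ n → ∀ {x} → Orbits n x → M n x
    Orbits⊆M {n} r₀≤n {x} (p , p∈ , x∈) = proj₂ (saturated n r₀≤n x) (MInf-orbit (All.lookup G⊆M∞ p∈) x∈)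

    M⊆MonOrbits : ∀ {n} → r₀ ≤ n → ∀ {v} → M n v → Mon (Orbits n) v
    M⊆MonOrbits {n} r₀≤n {v} Mv with proj₁ (M∞≡MonIncG n v) (proj₁ (saturated n r₀≤n v) Mv)
    ... | N , n≤N , v∈ = subst (Mon (Orbits n)) (trans (padTo-padTo n N v n≤N) (padTo-self v))
      (Mon-restrict n restrict v∈ v0)
      where
      v0 : VanishesFrom n (coord (padTo N v))
      v0 k n≤k = trans (coord-padTo N v (vanishesFrom-mono n≤N (coord-vanishes v)) k) (coord-vanishes v k n≤k)
      restrict : ∀ {a} → IncGImage G N a → VanishesFrom n (coord a) → Orbits n (padTo n a)
      restrict (p@(q , g) , p∈ , π , π-inc , refl) a0 =
        p , p∈ , orbit-padTo n (orbit-act π-inc (orbit-self {g = g} {x = g} λ _ → refl)) a0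

    finGen : ∀ n → R ≤ n → FinGenMonoid (M n)
    finGen n R≤n = concatMap (λ p → orbitList p n) G , λ v →
      Mon-mono listed ∘ M⊆MonOrbits r₀≤n , M-closed n ∘ Mon-mono (Orbits⊆M r₀≤n ∘ unlisted)
      where
      r₀≤n = ≤-trans r₀≤R R≤n
      listed : ∀ {x} → Orbits n x → x ∈ concatMap (λ p → orbitList p n) G
      listed (p , p∈ , x∈) = ∈-concat⁺′ (orbitList-complete n x∈) (∈-map⁺ (λ p → orbitList p n) p∈)
      unlisted : ∀ {x} → x ∈ concatMap (λ p → orbitList p n) G → Orbits n x
      unlisted x∈ with ∈-concat⁻′ (map (λ p → orbitList p n) G) x∈
      ... | xs , x∈xs , xs∈ with ∈-map⁻ (λ p → orbitList p n) xs∈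
      ...   | p , p∈ , refl = p , p∈ , orbitList-sound n x∈xs

    stable : ∀ m n → R ≤ m → m ≤ n → ∀ v → (Mon (IncImage M m n) v → M n v) × (M n v → Mon (IncImage M m n) v)
    stable m n R≤m m≤n v = Mon-IncImage⊆M m n , Mon-mono factor ∘ M⊆MonOrbits (≤-trans r₀≤m m≤n)
      where
      r₀≤m = ≤-trans r₀≤R R≤m
      factor : ∀ {x} → Orbits n x → IncImage M m n x
      factor (p , p∈ , x∈) with orbit-factor n (≤-trans (length≤R p∈) R≤m) m≤n x∈
      ... | τ , τ-inc , w , w∈ , x≡ = τ , τ-inc , w , Orbits⊆M r₀≤m (p , p∈ , w∈) , x≡

  b⇒a : EventuallySaturated M → CondB M → CondA M
  b⇒a (_ , saturated) (_ , G⊆M∞ , M∞≡MonIncG) = (R , stable) , (R , finGen)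
    where open Saturated saturated G⊆M∞ M∞≡MonIncG

corollary5p14 : (M : Chain) → IsIncInvariantChainOfMonoids M →
    (CondA M → CondB M)
    × (EventuallySaturated M → (CondA M → CondB M) × (CondB M → CondA M))
corollary5p14 M inv = a⇒b , λ saturated → a⇒b , b⇒a saturated
  where open IncInvariantChain M inv
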